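{- Let $a$ and $b$ be positive integers, let $g=g_{a,b}$, and let $B_k$ ($k\in\mathbb{N}$) be as defined below. Then for each $z\in\mathbb{N}$, $\lfloor z^{1/(a+b)}\rfloor$ is the smallest non-negative integer $m$ such that $z\in B_m$.
   Context: $\mathbb{N}$ denotes the non-negative integers. For positive integers $a,b$ and $x\in\mathbb{N}$, $g_{a,b}(x)=\bigl(\lfloor\sqrt[a]{x}\rfloor+1\bigr)^b-1$ (a non-decreasing unbounded function $\mathbb{N}\to\mathbb{N}$). For such $g$, $g^+(y)$ is the smallest $x\in\mathbb{N}$ with $g(x)\ge y$; the step points of $g$ are the elements of the range of $g^+$, listed increasingly as $s_0<s_1<s_2<\cdots$; and for $k\in\mathbb{N}$, $B_k=\{0,1,\ldots,s_{k+1}(g(s_k)+1)-1\}$. -}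

module Defs where

open import Data.Nat using (ℕ; zero; suc; _+_; _*_; _∸_; _^_; _≤_; _<_; _≤?_)
open import Data.Product using (Σ; _×_; ∃)
open import Relation.Binary.PropositionalEquality using (_≡_)
open import Relation.Nullary using (yes; no)

rootSearch : ℕ → ℕ → ℕ → ℕ
rootSearch a x zero = zero
rootSearch a x (suc n) with suc n ^ a ≤? x
... | yes _ = suc n
... | no _ = rootSearch a x n

-- ⌊ x^(1/a) ⌋ : the largest n with n ^ a ≤ x (meaningful for a ≥ 1,
-- where this n is ≤ x)
iroot : ℕ → ℕ → ℕ
iroot a x = rootSearch a x x

g : ℕ → ℕ → ℕ → ℕ
g a b x = (iroot a x + 1) ^ b ∸ 1

IsGPlus : (ℕ → ℕ) → (ℕ → ℕ) → Set
IsGPlus f gp = (∀ y → y ≤ f (gp y)) × (∀ y x → y ≤ f x → gp y ≤ x)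

IsStepEnum : (ℕ → ℕ) → (ℕ → ℕ) → Set
IsStepEnum gp s =
  (∀ k → s k < s (suc k)) ×
  (∀ k → ∃ λ y → gp y ≡ s k) ×
  (∀ y → ∃ λ k → s k ≡ gp y)

InB : (ℕ → ℕ) → (ℕ → ℕ) → ℕ → ℕ → Set
InB f s k z = z < s (suc k) * (f (s k) + 1)

module Submission where

-- Write a, b ≥ 1 and r = ⌊x^(1/a)⌋, so g x = (r + 1)^b - 1.
--   1. iroot a x is the greatest r with r^a ≤ x; hence x < (r + 1)^a, and
--      x < (m + 1)^a forces iroot a x ≤ m.  In particular iroot a (n^a) = n.
--   2. g x depends only on r, and g x + 1 = (r + 1)^b.  Consequently every
--      value of g⁺ is a perfect a-th power, and g⁺ (n^b) = n^a: the step
--      points are exactly the perfect a-th powers.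
--   3. Two strictly increasing sequences with the same range coincide; hence
--      the step-point enumeration is s k = k^a.
--   4. Therefore s (m+1) * (g (s m) + 1) = (m+1)^a (m+1)^b = (m+1)^(a+b), so
--      z ∈ B_m  ⇔  z < (m+1)^(a+b)  ⇔  ⌊z^(1/(a+b))⌋ ≤ m  by step 1.
-- The file follows these four steps in order; the theorem comes last.

open import Defs
open import Data.Nat using (ℕ; zero; suc; _+_; _*_; _∸_; _^_; _<_; _≤_; _≤?_; _<?_; z≤n; s≤s)
open import Data.Nat.Properties
open import Data.Nat.Induction using (<-rec)
open import Data.Sum using (inj₁; inj₂)
open import Data.Product using (_×_; _,_; ∃)
open import Function using (_∘_)
open import Relation.Nullary using (¬_; yes; no; contradiction)
open import Relation.Binary.PropositionalEquality

^-cancelˡ-< : ∀ a {m n} → m ^ a < n ^ a → m < n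
^-cancelˡ-< a {m} {n} mᵃ<nᵃ with m <? n
... | yes m<n = m<n
... | no m≮n = contradiction (^-monoˡ-≤ a (≮⇒≥ m≮n)) (<⇒≱ mᵃ<nᵃ)

-- A base never exceeds its positive power; it bounds the search range of iroot.
m≤m^[1+e] : ∀ e m → m ≤ m ^ suc e
m≤m^[1+e] e zero = z≤n
m≤m^[1+e] e m@(suc _) = m≤m*n m (m ^ e) {{m^n≢0 m e}}

rootSearch-fits : ∀ e x n → rootSearch (suc e) x n ^ suc e ≤ x
rootSearch-fits e x zero = z≤n
rootSearch-fits e x (suc n) with suc n ^ suc e ≤? x
... | yes fits = fits
... | no _ = rootSearch-fits e x n

rootSearch-greatest : ∀ a x n {m} → m ≤ n → m ^ a ≤ x → m ≤ rootSearch a x n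
rootSearch-greatest a x zero m≤0 _ = m≤0
rootSearch-greatest a x (suc n) {m} m≤1+n mᵃ≤x with suc n ^ a ≤? x
... | yes _ = m≤1+n
... | no 1+nᵃ≰x with m≤n⇒m<n∨m≡n m≤1+n
...   | inj₁ m<1+n = rootSearch-greatest a x n (≤-pred m<1+n) mᵃ≤x
...   | inj₂ refl = contradiction mᵃ≤x 1+nᵃ≰x

iroot-fits : ∀ e x → iroot (suc e) x ^ suc e ≤ x
iroot-fits e x = rootSearch-fits e x x

-- iroot is the greatest m with m^a ≤ x (such m are ≤ x, the search range).
iroot-greatest : ∀ e {x m} → m ^ suc e ≤ x → m ≤ iroot (suc e) x
iroot-greatest e {x} {m} mᵃ≤x =
  rootSearch-greatest (suc e) x x (≤-trans (m≤m^[1+e] e m) mᵃ≤x) mᵃ≤x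

iroot-bracket : ∀ e x → x < suc (iroot (suc e) x) ^ suc e
iroot-bracket e x with x <? suc (iroot (suc e) x) ^ suc e
... | yes below = below
... | no not-below = contradiction (iroot-greatest e (≮⇒≥ not-below)) (n≮n _)

iroot-≤ : ∀ e {x m} → x < suc m ^ suc e → iroot (suc e) x ≤ m
iroot-≤ e {x} x<[1+m]ᵃ =
  ≤-pred (^-cancelˡ-< (suc e) (≤-<-trans (iroot-fits e x) x<[1+m]ᵃ))

iroot-pow : ∀ e n → iroot (suc e) (n ^ suc e) ≡ n
iroot-pow e n = ≤-antisym (iroot-≤ e (^-monoˡ-< (suc e) (n<1+n n))) (iroot-greatest e ≤-refl)

g+1 : ∀ a b x → g a b x + 1 ≡ suc (iroot a x) ^ b
g+1 a b x = begin
  (r + 1) ^ b ∸ 1 + 1 ≡⟨ cong (λ t → t ^ b ∸ 1 + 1) (+-comm r 1) ⟩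
  suc r ^ b ∸ 1 + 1   ≡⟨ m∸n+n≡m (m^n>0 (suc r) b) ⟩
  suc r ^ b           ∎
  where
  open ≡-Reasoning
  r = iroot a x

≤-g⇒< : ∀ a b {x y} → y ≤ g a b x → y < suc (iroot a x) ^ b
≤-g⇒< a b {x} y≤gx = subst (_ <_) (trans (+-comm 1 (g a b x)) (g+1 a b x)) (s≤s y≤gx)

<⇒≤-g : ∀ a b {x y} → y < suc (iroot a x) ^ b → y ≤ g a b x
<⇒≤-g a b {x} y<rᵇ =
  ≤-pred (subst (_ <_) (sym (trans (+-comm 1 (g a b x)) (g+1 a b x))) y<rᵇ)

-- g is constant between consecutive a-th powers, so a least point of a level
-- of g (a value of g⁺) is always a perfect a-th power.
g⁺-power : ∀ e b {gp} → IsGPlus (g (suc e) b) gp → ∀ y → ∃ λ n → gp y ≡ n ^ suc e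
g⁺-power e b {gp} (fits , least) y = r , ≤-antisym (least y (r ^ suc e) y≤g[rᵃ]) (iroot-fits e x)
  where
  x = gp y
  r = iroot (suc e) x
  y≤g[rᵃ] : y ≤ g (suc e) b (r ^ suc e)
  y≤g[rᵃ] = subst (y ≤_) (cong (λ t → (t + 1) ^ b ∸ 1) (sym (iroot-pow e r))) (fits y)

g⁺-of-power : ∀ e f {gp} → IsGPlus (g (suc e) (suc f)) gp →
  ∀ n → gp (n ^ suc f) ≡ n ^ suc e
g⁺-of-power e f {gp} (fits , least) n = ≤-antisym (least _ (n ^ suc e) nᵇ≤g[nᵃ]) nᵃ≤x
  where
  nᵇ≤g[nᵃ] : n ^ suc f ≤ g (suc e) (suc f) (n ^ suc e)
  nᵇ≤g[nᵃ] = <⇒≤-g (suc e) (suc f) {n ^ suc e}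
    (subst (λ t → n ^ suc f < suc t ^ suc f) (sym (iroot-pow e n))
           (^-monoˡ-< (suc f) (n<1+n n)))
  x = gp (n ^ suc f)
  n≤r : n ≤ iroot (suc e) x
  n≤r = ≤-pred (^-cancelˡ-< (suc f) (≤-g⇒< (suc e) (suc f) {x} (fits (n ^ suc f))))
  nᵃ≤x : n ^ suc e ≤ x
  nᵃ≤x = ≤-trans (^-monoˡ-≤ (suc e) n≤r) (iroot-fits e x)

StrictlyIncreasing : (ℕ → ℕ) → Set
StrictlyIncreasing s = ∀ k → s k < s (suc k)

RangeWithin : (ℕ → ℕ) → (ℕ → ℕ) → Set
RangeWithin s t = ∀ k → ∃ λ n → s k ≡ t n

strict-mono : ∀ {s} → StrictlyIncreasing s → ∀ {i j} → i < j → s i < s j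
strict-mono inc {i} (s≤s i≤j) with m≤n⇒m<n∨m≡n i≤j
... | inj₁ i<j = <-trans (strict-mono inc i<j) (inc _)
... | inj₂ refl = inc i

mono : ∀ {s} → StrictlyIncreasing s → ∀ {i j} → i ≤ j → s i ≤ s j
mono inc i≤j with m≤n⇒m<n∨m≡n i≤j
... | inj₁ i<j = <⇒≤ (strict-mono inc i<j)
... | inj₂ refl = ≤-refl

-- If s and t agree below j and t j is a value of s, then s j ≤ t j: the index
-- of t j in s cannot lie below j, where s and t already agree.
agree-below⇒≤ : ∀ {s t} → StrictlyIncreasing s → StrictlyIncreasing t → ∀ j →
  (∀ {i} → i < j → s i ≡ t i) → RangeWithin t s → s j ≤ t j
agree-below⇒≤ {s} {t} s-inc t-inc j agree t⊆s with t⊆s j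
... | j′ , tj≡sj′ = subst (s j ≤_) (sym tj≡sj′) (mono s-inc j≤j′)
  where
  j≤j′ : j ≤ j′
  j≤j′ with j′ <? j
  ... | no j′≮j = ≮⇒≥ j′≮j
  ... | yes j′<j = contradiction
    (subst₂ _<_ (sym (agree j′<j)) tj≡sj′ (strict-mono t-inc j′<j)) (n≮n _)

same-range⇒equal : ∀ {s t} → StrictlyIncreasing s → StrictlyIncreasing t →
  RangeWithin s t → RangeWithin t s → ∀ k → s k ≡ t k
same-range⇒equal s-inc t-inc s⊆t t⊆s = <-rec _ λ j agree →
  ≤-antisym (agree-below⇒≤ s-inc t-inc j agree t⊆s)
            (agree-below⇒≤ t-inc s-inc j (sym ∘ agree) s⊆t)

step-points : ∀ e f {gp s} → IsGPlus (g (suc e) (suc f)) gp → IsStepEnum gp s →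
  ∀ k → s k ≡ k ^ suc e
step-points e f {s = s} g⁺ (s-inc , s⊆g⁺ , g⁺⊆s) =
  same-range⇒equal s-inc (λ n → ^-monoˡ-< (suc e) (n<1+n n)) s⊆powers powers⊆s
  where
  s⊆powers : RangeWithin s (_^ suc e)
  s⊆powers k with s⊆g⁺ k
  ... | y , gpy≡sk with g⁺-power e (suc f) g⁺ y
  ...   | n , gpy≡nᵃ = n , trans (sym gpy≡sk) gpy≡nᵃ
  powers⊆s : RangeWithin (_^ suc e) s
  powers⊆s n with g⁺⊆s (n ^ suc f)
  ... | k , sk≡gp = k , sym (trans sk≡gp (g⁺-of-power e f g⁺ n))

B-bound : ∀ e f {gp s} → IsGPlus (g (suc e) (suc f)) gp → IsStepEnum gp s →
  ∀ m → s (suc m) * (g (suc e) (suc f) (s m) + 1) ≡ suc m ^ (suc e + suc f)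
B-bound e f {s = s} g⁺ enum m = begin
  s (suc m) * (g a b (s m) + 1)        ≡⟨ cong₂ _*_ (step (suc m)) (g+1 a b (s m)) ⟩
  suc m ^ a * suc (iroot a (s m)) ^ b  ≡⟨ cong (λ r → suc m ^ a * suc r ^ b) root-sm ⟩
  suc m ^ a * suc m ^ b                ≡⟨ sym (^-distribˡ-+-* (suc m) a b) ⟩
  suc m ^ (a + b)                      ∎
  where
  open ≡-Reasoning
  a = suc e
  b = suc f
  step = step-points e f g⁺ enum
  root-sm : iroot a (s m) ≡ m
  root-sm = trans (cong (iroot a) (step m)) (iroot-pow e m)

lemma5p3 : (a b : ℕ) → 1 ≤ a → 1 ≤ b →
    (gp s : ℕ → ℕ) → IsGPlus (g a b) gp → IsStepEnum gp s →
    (z : ℕ) →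
      InB (g a b) s (iroot (a + b) z) z ×
      (∀ m → m < iroot (a + b) z → ¬ InB (g a b) s m z)
lemma5p3 (suc e) (suc f) _ _ gp s g⁺ enum z = z∈B[root] , z∉B[<root]
  where
  c = e + suc f  -- a + b = suc c, the exponent of the root
  z∈B[root] : InB (g (suc e) (suc f)) s (iroot (suc c) z) z
  z∈B[root] = subst (z <_) (sym (B-bound e f g⁺ enum _)) (iroot-bracket c z)
  z∉B[<root] : ∀ m → m < iroot (suc c) z → ¬ InB (g (suc e) (suc f)) s m z
  z∉B[<root] m m<root z∈Bm =
    <⇒≱ m<root (iroot-≤ c (subst (z <_) (B-bound e f g⁺ enum m) z∈Bm))
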